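{- For any partition $\mu$ of $n$ and any multiset of positive integers $A=\{a_1\le a_2\le\cdots\le a_n\}$, $$\mathcal{C}_A(\mu)=\bigsqcup_{i=1}^{\ell(\mu)}x_n^{i-1}\cdot\mathcal{C}_A^{(i-1)}(\mu^{(i)}),$$ where the union is disjoint.
   Context: A word on $\{0,1,2,\dots\}$ is Yamanouchi if every suffix contains at least as many $i$'s as $(i+1)$'s for all $i\ge0$; it has content $\lambda$ if exactly $\lambda_i$ letters equal $i-1$. A word $w_1\cdots w_m$ of nonnegative integers is $\lambda$-sub-Yamanouchi if there is a Yamanouchi word $v$ of content $\lambda$ and length $m$ with $w_i\le v_i$ for all $i$. For an ordered multiset $B=\{b_1\le\cdots\le b_m\}$, a word $c_1\cdots c_m$ is $B$-weakly increasing if $c_j\le c_{j+1}$ whenever $b_j=b_{j+1}$. The monomial of a word $c=c_1\cdots c_m$ is $x^c=x_m^{c_1}x_{m-1}^{c_2}\cdots x_1^{c_m}$. $\mathcal{C}_A(\mu)$ is the set of monomials $x^c$ of $\mu$-sub-Yamanouchi, $A$-weakly increasing words $c$ of length $n$. For a partition $\lambda$ of $n-1$ and integer $t$, $\mathcal{C}^{(t)}_A(\lambda)$ is the set of monomials $x^d$ of $\lambda$-sub-Yamanouchi words $d_1\cdots d_{n-1}$ that are $\{a_2\le\cdots\le a_n\}$-weakly increasing and satisfy $d_1\ge t$ if $a_1=a_2$. $\ell(\mu)$ is the number of parts of $\mu$, and $\mu^{(i)}$ is obtained from $\mu$ by removing the top cell of the column containing the last cell of row $i$ (equivalently, decreasing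 by one the part $\mu_j$ with the largest index $j$ such that $\mu_j=\mu_i$). For a monomial $m$ and a set $\mathcal{C}$ of monomials, $m\cdot\mathcal{C}=\{mx:x\in\mathcal{C}\}$. -}

module Defs where

open import Data.Nat using (ℕ; zero; suc; _+_; _∸_; _≤_; _<_; _≡ᵇ_)
open import Data.Bool using (Bool; true; false; if_then_else_; _∧_; not)
open import Data.List as L using (List; []; _∷_; drop; length)
open import Data.Nat.ListAction using (sum)
open import Data.Bool.ListAction using (any)
open import Data.Vec as V using (Vec; toList; reverse; zipWith; replicate; _++_)
import Data.Vec.Relation.Binary.Pointwise.Inductive as PW
open import Data.Product using (Σ; _×_; ∃)
open import Data.Unit using (⊤)
open import Data.Fin using (Fin; toℕ)
open import Relation.Binary.PropositionalEquality using (_≡_)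
open import Data.List.Relation.Unary.All using (All)

count : ℕ → List ℕ → ℕ
count a [] = 0
count a (x ∷ xs) = if a ≡ᵇ x then suc (count a xs) else count a xs

Yamanouchi : List ℕ → Set
Yamanouchi w = ∀ (k i : ℕ) → count (suc i) (drop k w) ≤ count i (drop k w)

-- partAt λ j = λ_{j+1} (the (j+1)-st part), 0 beyond the length
partAt : List ℕ → ℕ → ℕ
partAt [] j = 0
partAt (x ∷ xs) zero = x
partAt (x ∷ xs) (suc j) = partAt xs j

-- content λ: exactly λ_i letters equal to i-1 (and no other letters)
HasContent : List ℕ → List ℕ → Set
HasContent lam w = ∀ (j : ℕ) → count j w ≡ partAt lam j

SubYamanouchi : ∀ {m} → List ℕ → Vec ℕ m → Set
SubYamanouchi {m} lam w =
  Σ (Vec ℕ m) λ v → Yamanouchi (toList v) × HasContent lam (toList v) × PW.Pointwise _≤_ w v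

WeaklyIncr : List ℕ → List ℕ → Set
WeaklyIncr (b ∷ b' ∷ bs) (c ∷ c' ∷ cs) = (b ≡ b' → c ≤ c') × WeaklyIncr (b' ∷ bs) (c' ∷ cs)
WeaklyIncr _ _ = ⊤

Decreasing : List ℕ → Set
Decreasing (x ∷ y ∷ xs) = y ≤ x × Decreasing (y ∷ xs)
Decreasing _ = ⊤

IsPartitionOf : ℕ → List ℕ → Set
IsPartitionOf n μ = All (λ x → 0 < x) μ × Decreasing μ × sum μ ≡ n

IsOrderedMultiset : ∀ {n} → Vec ℕ n → Set
IsOrderedMultiset a = All (λ x → 0 < x) (toList a) × Decreasing (L.reverse (toList a))

-- Monomials in x_1..x_m, as exponent vectors: index j holds the exponent of x_{j+1}
Monomial : ℕ → Set
Monomial m = Vec ℕ m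

-- x^c = x_m^{c_1} x_{m-1}^{c_2} ... x_1^{c_m}
mono : ∀ {m} → Vec ℕ m → Monomial m
mono c = reverse c

_·ₘ_ : ∀ {m} → Monomial m → Monomial m → Monomial m
_·ₘ_ = zipWith _+_

embed : ∀ {k} → Monomial k → Monomial (suc k)
embed m = m V.∷ʳ 0

xLast^ : (k e : ℕ) → Monomial (suc k)
xLast^ k e = replicate k 0 V.∷ʳ e

-- μ^{(i)}: decrease by one the last part equal to value v = μ_i (dropping it if it becomes 0)
decLast : ℕ → List ℕ → List ℕ
decLast v [] = []
decLast v (x ∷ xs) with (v ≡ᵇ x) ∧ not (any (v ≡ᵇ_) xs)
... | false = x ∷ decLast v xs
... | true with x
...   | zero = xs
...   | suc zero = xs
...   | suc (suc y) = suc y ∷ xs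

removeCell : (μ : List ℕ) → Fin (length μ) → List ℕ
removeCell μ i = decLast (L.lookup μ i) μ

C : ∀ {n} → Vec ℕ n → List ℕ → Monomial n → Set
C {n} A μ m = Σ (Vec ℕ n) λ c →
  SubYamanouchi μ c × WeaklyIncr (toList A) (toList c) × mono c ≡ m

FirstCond : List ℕ → List ℕ → ℕ → Set
FirstCond (a₁ ∷ a₂ ∷ _) (d₁ ∷ _) t = a₁ ≡ a₂ → t ≤ d₁
FirstCond _ _ _ = ⊤

Ct : ∀ {k} → Vec ℕ (suc k) → ℕ → List ℕ → Monomial k → Set
Ct {k} A t lam m = Σ (Vec ℕ k) λ d →
  SubYamanouchi lam d × WeaklyIncr (toList (V.tail A)) (toList d)
  × FirstCond (toList A) (toList d) t × mono d ≡ m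

-- membership in  x_n^{i-1} · 𝒞^{(i-1)}_A(μ^{(i)})  (here i-1 = toℕ i, n = k+1)
Piece : ∀ {k} → Vec ℕ (suc k) → (μ : List ℕ) → Fin (length μ) → Monomial (suc k) → Set
Piece {k} A μ i m = Σ (Monomial k) λ m' →
  Ct A (toℕ i) (removeCell μ i) m' × m ≡ (xLast^ k (toℕ i) ·ₘ embed m')

-- Write c = c₁ d. The word c is μ-sub-Yamanouchi exactly when c₁ < ℓ(μ) and d is
-- μ^{(c₁+1)}-sub-Yamanouchi, so x^c = x_n^{c₁} x^d lies in the piece indexed by the exponent
-- of x_n, and in no other. Let J ≥ c₁ be the row whose last cell μ^{(c₁+1)} removes; it is a
-- corner of μ. Prepending J to a Yamanouchi word dominating d gives one dominating c.
-- Conversely, if the Yamanouchi word v₁ v′ dominates c, then v₁ is also a corner of μ, which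
-- forces J ≤ v₁; the content μ^{(c₁+1)} arises from that of v′ by turning one letter J into
-- v₁, and such a raise of a letter is always realised by a Yamanouchi word dominating v′.
-- Finally, A-weak increase of c splits into the condition on d and d₁ ≥ c₁ when a₁ = a₂.
module Submission where

open import Data.Bool using (true; false; T; if_then_else_)
open import Data.Bool.ListAction using (any)
open import Data.Bool.Properties using (T-≡)
open import Data.Fin as Fin using (Fin; toℕ; fromℕ<)
open import Data.Fin.Properties using (toℕ-fromℕ<; toℕ-injective; toℕ<n)
open import Data.List as L using (List; []; _∷_; length)
open import Data.List.Relation.Unary.All using (All; []; _∷_)
open import Data.List.Relation.Unary.Any as Any using (Any; here; there)
open import Data.List.Relation.Unary.Any.Properties using (any⁺)
open import Data.Nat
open import Data.Nat.Properties
open import Data.Nat.Tactic.RingSolver using (solve-∀)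
open import Data.Product using (Σ; ∃; _×_; _,_; swap)
open import Data.Sum using (inj₁; inj₂)
open import Data.Unit using (tt)
open import Data.Vec as V using (Vec; []; _∷_; _∷ʳ_; toList)
open import Data.Vec.Properties using (reverse-∷; ∷ʳ-injectiveʳ)
import Data.Vec.Relation.Binary.Pointwise.Inductive as PW
open import Function using (_∘′_)
open import Function.Bundles using (_⇔_; mk⇔; Equivalence)
open import Relation.Nullary using (Dec; yes; no; contradiction)
open import Relation.Binary.PropositionalEquality

open import Defs

≡ᵇ-refl : ∀ n → (n ≡ᵇ n) ≡ true
≡ᵇ-refl zero    = refl
≡ᵇ-refl (suc n) = ≡ᵇ-refl n

≢⇒≡ᵇ-false : ∀ {m n} → m ≢ n → (m ≡ᵇ n) ≡ false
≢⇒≡ᵇ-false {zero}  {zero}  m≢n = contradiction refl m≢n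
≢⇒≡ᵇ-false {zero}  {suc n} _   = refl
≢⇒≡ᵇ-false {suc m} {zero}  _   = refl
≢⇒≡ᵇ-false {suc m} {suc n} m≢n = ≢⇒≡ᵇ-false (m≢n ∘′ cong suc)

δ : ℕ → ℕ → ℕ
δ i j = if i ≡ᵇ j then 1 else 0

δ-refl : ∀ i → δ i i ≡ 1
δ-refl i rewrite ≡ᵇ-refl i = refl

δ-≢ : ∀ {i j} → i ≢ j → δ i j ≡ 0
δ-≢ i≢j rewrite ≢⇒≡ᵇ-false i≢j = refl

count-∷ : ∀ i x w → count i (x ∷ w) ≡ δ i x + count i w
count-∷ i x w with i ≡ᵇ x
... | true  = refl
... | false = refl

count-head : ∀ x w → count x (x ∷ w) ≡ suc (count x w)
count-head x w = trans (count-∷ x x w) (cong (_+ count x w) (δ-refl x))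

-- Contents and partitions are functions ℕ → ℕ (letter or row i ↦ multiplicity or part).
Content : List ℕ → (ℕ → ℕ) → Set
Content w g = ∀ i → count i w ≡ g i

Nonincreasing : (ℕ → ℕ) → Set
Nonincreasing g = ∀ i → g (suc i) ≤ g i

nonincreasing-antitone : ∀ {g m n} → Nonincreasing g → m ≤ n → g n ≤ g m
nonincreasing-antitone {g} g↓ m≤n = go (≤⇒≤′ m≤n)
  where
  go : ∀ {m n} → m ≤′ n → g n ≤ g m
  go ≤′-refl        = ≤-refl
  go (≤′-step m≤′n) = ≤-trans (g↓ _) (go m≤′n)

removal-nonincreasing : ∀ {g h y} → (∀ i → h i + δ i y ≡ g i) →
  Nonincreasing g → g (suc y) < g y → Nonincreasing h
removal-nonincreasing {g} {h} {y} h+δ≡g g↓ corner i = ≤-trans (h≤g (suc i)) (g-below (i ≟ y))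
  where
  h≤g : ∀ j → h j ≤ g j
  h≤g j = subst (h j ≤_) (h+δ≡g j) (m≤m+n (h j) (δ j y))
  g-below : Dec (i ≡ y) → g (suc i) ≤ h i
  g-below (yes refl) = s≤s⁻¹ (subst (g (suc i) <_) gi≡1+hi corner)
    where
    gi≡1+hi : g i ≡ suc (h i)
    gi≡1+hi = trans (sym (h+δ≡g i)) (trans (cong (h i +_) (δ-refl i)) (+-comm (h i) 1))
  g-below (no i≢y) = subst (g (suc i) ≤_) gi≡hi (g↓ i)
    where
    gi≡hi : g i ≡ h i
    gi≡hi = trans (sym (h+δ≡g i)) (trans (cong (h i +_) (δ-≢ i≢y)) (+-identityʳ (h i)))

yamanouchi-∷ : ∀ {x w g} →
  Nonincreasing g → Content (x ∷ w) g → Yamanouchi w → Yamanouchi (x ∷ w)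
yamanouchi-∷ g↓ content _   zero    i = subst₂ _≤_ (sym (content (suc i))) (sym (content i)) (g↓ i)
yamanouchi-∷ _  _       yam (suc k) i = yam k i

yamanouchi-tail : ∀ {x w} → Yamanouchi (x ∷ w) → Yamanouchi w
yamanouchi-tail yam k = yam (suc k)

yamanouchi-head-corner : ∀ {x w} →
  Yamanouchi (x ∷ w) → count (suc x) (x ∷ w) < count x (x ∷ w)
yamanouchi-head-corner {x} {w} yam = begin-strict
  count (suc x) (x ∷ w)         ≡⟨ count-∷ (suc x) x w ⟩
  δ (suc x) x + count (suc x) w ≡⟨ cong (_+ count (suc x) w) (δ-≢ (1+n≢n {x})) ⟩
  count (suc x) w               ≤⟨ yam 1 x ⟩
  count x w                     <⟨ n<1+n _ ⟩
  suc (count x w)               ≡⟨ count-head x w ⟨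
  count x (x ∷ w)               ∎
  where open ≤-Reasoning

-- SubYamanouchi λ is SubYamanouchi′ (partAt λ), definitionally.
SubYamanouchi′ : ∀ {n} → (ℕ → ℕ) → Vec ℕ n → Set
SubYamanouchi′ {n} g u =
  Σ (Vec ℕ n) λ v → Yamanouchi (toList v) × Content (toList v) g × PW.Pointwise _≤_ u v

subYamanouchi′-≤ : ∀ {n g} {u w : Vec ℕ n} →
  PW.Pointwise _≤_ w u → SubYamanouchi′ g u → SubYamanouchi′ g w
subYamanouchi′-≤ w≤u (v , yam , content , u≤v) = v , yam , content , PW.trans ≤-trans w≤u u≤v

-- g minus one cell in row y; because of truncated subtraction only meaningful when 0 < g y.
_⊖_ : (ℕ → ℕ) → ℕ → ℕ → ℕ
(g ⊖ y) i = g i ∸ δ i y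

⊖-+δ : ∀ {g y} → 0 < g y → ∀ i → (g ⊖ y) i + δ i y ≡ g i
⊖-+δ {g} {y} gy>0 i with i ≟ y
... | yes refl = m∸n+n≡m (subst (_≤ g i) (sym (δ-refl i)) gy>0)
... | no i≢y   = m∸n+n≡m (subst (_≤ g i) (sym (δ-≢ i≢y)) z≤n)

subYamanouchi′-∷ : ∀ {n g x y} {w : Vec ℕ n} → x ≤ y → Nonincreasing g → g (suc y) < g y →
  SubYamanouchi′ (g ⊖ y) w → SubYamanouchi′ g (x ∷ w)
subYamanouchi′-∷ {g = g} {y = y} x≤y g↓ corner (v , yam , content , w≤v) =
  y ∷ v , yamanouchi-∷ g↓ content′ yam , content′ , x≤y PW.∷ w≤v
  where
  content′ : Content (y ∷ toList v) g
  content′ i = begin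
    count i (y ∷ toList v)      ≡⟨ count-∷ i y (toList v) ⟩
    δ i y + count i (toList v)  ≡⟨ cong (δ i y +_) (content i) ⟩
    δ i y + (g ⊖ y) i           ≡⟨ +-comm (δ i y) _ ⟩
    (g ⊖ y) i + δ i y           ≡⟨ ⊖-+δ (≤-<-trans z≤n corner) i ⟩
    g i                         ∎
    where open ≡-Reasoning

⊖-nonincreasing : ∀ {g y} → Nonincreasing g → g (suc y) < g y → Nonincreasing (g ⊖ y)
⊖-nonincreasing g↓ corner = removal-nonincreasing (⊖-+δ (≤-<-trans z≤n corner)) g↓ corner

exchange-letters : ∀ {X B Y Z c h A} →
  X + B ≡ Y + Z → (X + c) + B ≡ (h + Y) + A → c + Z ≡ h + A
exchange-letters {X} {B} {Y} {Z} {c} {h} {A} XB≡YZ eq = +-cancelʳ-≡ Y (c + Z) (h + A) (begin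
  (c + Z) + Y    ≡⟨ +-assoc c Z Y ⟩
  c + (Z + Y)    ≡⟨ cong (c +_) (trans (+-comm Z Y) (sym XB≡YZ)) ⟩
  c + (X + B)    ≡⟨ sym (+-assoc c X B) ⟩
  (c + X) + B    ≡⟨ cong (_+ B) (+-comm c X) ⟩
  (X + c) + B    ≡⟨ eq ⟩
  (h + Y) + A    ≡⟨ +-assoc h Y A ⟩
  h + (Y + A)    ≡⟨ cong (h +_) (+-comm Y A) ⟩
  h + (A + Y)    ≡⟨ sym (+-assoc h A Y) ⟩
  (h + A) + Y    ∎)
  where open ≡-Reasoning

-- Scan u from the left: a head x ≠ a after which g still drops is kept; otherwise b is
-- written in its place (then x = a or b = x + 1) and the tail has to raise a to x instead.
raise-letter : ∀ {n g a b} (u : Vec ℕ n) → a ≤ b → Nonincreasing g → Yamanouchi (toList u) →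
  (∀ i → count i (toList u) + δ i b ≡ g i + δ i a) → SubYamanouchi′ g u
raise-letter u a≤b g↓ yam eq with m≤n⇒m<n∨m≡n a≤b
raise-letter u _ g↓ yam eq | inj₂ refl = u , yam , (λ i → +-cancelʳ-≡ _ _ _ (eq i)) , PW.refl ≤-refl
raise-letter {g = g} {a} {b} [] _ g↓ yam eq | inj₁ a<b = contradiction (begin
  0              ≡⟨ δ-≢ (<⇒≢ a<b) ⟨
  δ a b          ≡⟨ eq a ⟩
  g a + δ a a    ≡⟨ cong (g a +_) (δ-refl a) ⟩
  g a + 1        ≡⟨ +-comm (g a) 1 ⟩
  suc (g a)      ∎) 0≢1+n
  where open ≡-Reasoning
raise-letter {g = g} {a} {b} (x ∷ w) _ g↓ yam eq | inj₁ a<b =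
  choose-head (x ≟ a) (g (suc x) <? g x)
  where
  w-yam : Yamanouchi (toList w)
  w-yam = yamanouchi-tail yam

  split-head : ∀ i → (δ i x + count i (toList w)) + δ i b ≡ g i + δ i a
  split-head i = trans (cong (_+ δ i b) (sym (count-∷ i x (toList w)))) (eq i)

  g≤count : ∀ {i} → i ≢ x → i ≢ b → g i ≤ count i (toList w)
  g≤count {i} i≢x i≢b = begin
    g i                                  ≤⟨ m≤m+n (g i) (δ i a) ⟩
    g i + δ i a                          ≡⟨ split-head i ⟨
    (δ i x + count i (toList w)) + δ i b ≡⟨ cong₂ (λ p q → (p + count i (toList w)) + q)
                                                   (δ-≢ i≢x) (δ-≢ i≢b) ⟩
    count i (toList w) + 0               ≡⟨ +-identityʳ _ ⟩
    count i (toList w)                   ∎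
    where open ≤-Reasoning

  count<g : ∀ {i} → i ≢ a → 1 ≤ δ i x + δ i b → count i (toList w) < g i
  count<g {i} i≢a 1≤δ = begin
    1 + count i (toList w)               ≤⟨ +-monoˡ-≤ (count i (toList w)) 1≤δ ⟩
    (δ i x + δ i b) + count i (toList w) ≡⟨ rearrange (δ i x) (δ i b) (count i (toList w)) ⟩
    (δ i x + count i (toList w)) + δ i b ≡⟨ split-head i ⟩
    g i + δ i a                          ≡⟨ cong (g i +_) (δ-≢ i≢a) ⟩
    g i + 0                              ≡⟨ +-identityʳ (g i) ⟩
    g i                                  ∎
    where
    open ≤-Reasoning
    rearrange : ∀ p q r → (p + q) + r ≡ (p + r) + q
    rearrange = solve-∀

  x-is-x-or-b : 1 ≤ δ x x + δ x b
  x-is-x-or-b = subst (λ e → 1 ≤ e + δ x b) (sym (δ-refl x)) (s≤s z≤n)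

  b-is-x-or-b : 1 ≤ δ b x + δ b b
  b-is-x-or-b = subst (λ e → 1 ≤ δ b x + e) (sym (δ-refl b)) (m≤n+m 1 (δ b x))

  corner-at-b : x < b → g (suc b) < g b
  corner-at-b x<b = begin-strict
    g (suc b)                ≤⟨ g≤count (>⇒≢ (m<n⇒m<1+n x<b)) 1+n≢n ⟩
    count (suc b) (toList w) ≤⟨ w-yam 0 b ⟩
    count b (toList w)       <⟨ count<g (>⇒≢ a<b) b-is-x-or-b ⟩
    g b                      ∎
    where open ≤-Reasoning

  tail-content : ∀ y z → (∀ i → δ i x + δ i b ≡ δ i y + δ i z) → g (suc y) < g y →
    ∀ i → count i (toList w) + δ i z ≡ (g ⊖ y) i + δ i a
  tail-content y z xb≡yz corner i =
    exchange-letters {δ i x} {δ i b} {δ i y} {δ i z} {h = (g ⊖ y) i} {δ i a}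
      (xb≡yz i) (trans (split-head i) (cong (_+ δ i a) g≡⊖+δ))
    where
    g≡⊖+δ : g i ≡ (g ⊖ y) i + δ i y
    g≡⊖+δ = sym (⊖-+δ {g} (≤-<-trans z≤n corner) i)

  raise-to-b : a ≤ x → x < b → SubYamanouchi′ g (x ∷ w)
  raise-to-b a≤x x<b = subYamanouchi′-∷ (<⇒≤ x<b) g↓ (corner-at-b x<b)
    (raise-letter w a≤x (⊖-nonincreasing g↓ (corner-at-b x<b)) w-yam
      (tail-content b x (λ i → +-comm (δ i x) (δ i b)) (corner-at-b x<b)))

  choose-head : Dec (x ≡ a) → Dec (g (suc x) < g x) → SubYamanouchi′ g (x ∷ w)
  choose-head (yes refl) _ = raise-to-b ≤-refl a<b
  choose-head (no _) (yes corner) = subYamanouchi′-∷ ≤-refl g↓ corner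
    (raise-letter w (<⇒≤ a<b) (⊖-nonincreasing g↓ corner) w-yam
      (tail-content x b (λ _ → refl) corner))
  choose-head (no x≢a) (no ¬corner) =
    raise-to-b (s≤s⁻¹ (subst (a <_) b≡1+x a<b)) (subst (x <_) (sym b≡1+x) (n<1+n x))
    where
    b≡1+x : b ≡ suc x
    b≡1+x with b ≟ suc x
    ... | yes b≡1+x = b≡1+x
    ... | no b≢1+x = contradiction (begin-strict
      g (suc x)                ≤⟨ g≤count 1+n≢n (b≢1+x ∘′ sym) ⟩
      count (suc x) (toList w) ≤⟨ w-yam 0 x ⟩
      count x (toList w)       <⟨ count<g x≢a x-is-x-or-b ⟩
      g x                      ∎) ¬corner
      where open ≤-Reasoning

decreasing-tail : ∀ {x xs} → Decreasing (x ∷ xs) → Decreasing xs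
decreasing-tail {xs = []}    _       = tt
decreasing-tail {xs = _ ∷ _} (_ , d) = d

partAt-nonincreasing : ∀ {μ} → Decreasing μ → Nonincreasing (partAt μ)
partAt-nonincreasing {[]}         _         _       = z≤n
partAt-nonincreasing {x ∷ []}     _         zero    = z≤n
partAt-nonincreasing {x ∷ []}     _         (suc i) = z≤n
partAt-nonincreasing {x ∷ y ∷ ys} (y≤x , _) zero    = y≤x
partAt-nonincreasing {x ∷ y ∷ ys} (_ , d)   (suc i) = partAt-nonincreasing d i

partAt-positive : ∀ {μ p} → All (0 <_) μ → p < length μ → 0 < partAt μ p
partAt-positive {p = zero}  (x>0 ∷ _)   _            = x>0
partAt-positive {p = suc p} (_ ∷ μ>0) (s≤s p<len) = partAt-positive μ>0 p<len

positive⇒<length : ∀ μ {p} → 0 < partAt μ p → p < length μ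
positive⇒<length (x ∷ μ) {zero}  _     = s≤s z≤n
positive⇒<length (x ∷ μ) {suc p} μp>0 = s≤s (positive⇒<length μ μp>0)

partAt-length : ∀ μ → partAt μ (length μ) ≡ 0
partAt-length []      = refl
partAt-length (_ ∷ μ) = partAt-length μ

lookup≡partAt : ∀ μ (i : Fin (length μ)) → L.lookup μ i ≡ partAt μ (toℕ i)
lookup≡partAt (x ∷ μ) Fin.zero    = refl
lookup≡partAt (x ∷ μ) (Fin.suc i) = lookup≡partAt μ i

PlateauEnd : (ℕ → ℕ) → ℕ → ℕ → Set
PlateauEnd g p J = p ≤ J × g J ≡ g p × g (suc J) < g J

plateauEnd : ∀ {g} → Nonincreasing g → ∀ k p → g (k + p) < g p → ∃ (PlateauEnd g p)
plateauEnd g↓ zero p gp<gp = contradiction gp<gp (<-irrefl refl)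
plateauEnd {g} g↓ (suc k) p drop with g (suc p) <? g p
... | yes corner = p , ≤-refl , refl , corner
... | no ¬corner = extend (≤-antisym (g↓ p) (≮⇒≥ ¬corner))
  where
  extend : g (suc p) ≡ g p → ∃ (PlateauEnd g p)
  extend flat with plateauEnd g↓ k (suc p) (subst₂ _<_ (cong g (sym (+-suc k p))) (sym flat) drop)
  ... | J , p<J , gJ≡ , corner = J , ≤-trans (n≤1+n p) p<J , trans gJ≡ flat , corner

partAt-∈ : ∀ {xs p} → p < length xs → Any (partAt xs p ≡_) xs
partAt-∈ {x ∷ xs} {zero}  _           = here refl
partAt-∈ {x ∷ xs} {suc p} (s≤s p<len) = there (partAt-∈ p<len)

any-≡ᵇ-partAt : ∀ {xs p} → p < length xs → T (any (partAt xs p ≡ᵇ_) xs)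
any-≡ᵇ-partAt {xs} {p} p<len =
  any⁺ (partAt xs p ≡ᵇ_) (Any.map (≡⇒≡ᵇ _ _) (partAt-∈ {xs} p<len))

any-≡ᵇ-false : ∀ {xs v} → Decreasing xs → partAt xs 0 < v → any (v ≡ᵇ_) xs ≡ false
any-≡ᵇ-false {[]}     _ _ = refl
any-≡ᵇ-false {y ∷ ys} d y<v rewrite ≢⇒≡ᵇ-false (>⇒≢ y<v) =
  any-≡ᵇ-false (decreasing-tail d) (≤-<-trans (partAt-nonincreasing d 0) y<v)

decLast-∷-∈ : ∀ {v x xs} → T (any (v ≡ᵇ_) xs) → decLast v (x ∷ xs) ≡ x ∷ decLast v xs
decLast-∷-∈ {v} {x} v∈xs rewrite Equivalence.to T-≡ v∈xs with v ≡ᵇ x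
... | true  = refl
... | false = refl

decLast-removes : ∀ {μ J} → Decreasing μ → All (0 <_) μ → partAt μ (suc J) < partAt μ J →
  ∀ j → partAt (decLast (partAt μ J) μ) j + δ j J ≡ partAt μ j
decLast-removes {[]} _ _ ()
decLast-removes {zero ∷ xs}          {zero} _ _ ()
decLast-removes {suc zero ∷ []}      {zero} _ _ _ zero    = refl
decLast-removes {suc zero ∷ []}      {zero} _ _ _ (suc j) = refl
-- decLast drops a part 1 entirely, so it must be the last part: parts are positive.
decLast-removes {suc zero ∷ y ∷ ys}  {zero} _ (_ ∷ s≤s _ ∷ _) (s≤s ())
decLast-removes {suc (suc y) ∷ xs}   {zero} d _ corner j
  rewrite ≡ᵇ-refl y | any-≡ᵇ-false (decreasing-tail d) corner with j
... | zero  = +-comm (suc y) 1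
... | suc j = +-identityʳ (partAt xs j)
decLast-removes {x ∷ xs} {suc J} d (_ ∷ xs>0) corner j =
  trans (cong (λ μ′ → partAt μ′ j + δ j (suc J)) (decLast-∷-∈ {partAt xs J} {x} {xs} J-in-xs))
        (removes-below-head j)
  where
  J-in-xs : T (any (partAt xs J ≡ᵇ_) xs)
  J-in-xs = any-≡ᵇ-partAt {xs} (positive⇒<length xs (≤-<-trans z≤n corner))
  removes-below-head : ∀ j →
    partAt (x ∷ decLast (partAt xs J) xs) j + δ j (suc J) ≡ partAt (x ∷ xs) j
  removes-below-head zero    = +-identityʳ x
  removes-below-head (suc j) = decLast-removes (decreasing-tail d) xs>0 corner j

record RemovedCorner (μ : List ℕ) (i : Fin (length μ)) : Set where
  constructor corner
  field
    row       : ℕ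
    i≤row     : toℕ i ≤ row
    same-part : partAt μ row ≡ partAt μ (toℕ i)
    is-corner : partAt μ (suc row) < partAt μ row
    removes   : ∀ j → partAt (removeCell μ i) j + δ j row ≡ partAt μ j

removeCell-corner : ∀ {μ} → Decreasing μ → All (0 <_) μ →
  (i : Fin (length μ)) → RemovedCorner μ i
removeCell-corner {μ} μ↓ μ>0 i
  with plateauEnd (partAt-nonincreasing μ↓) (length μ ∸ toℕ i) (toℕ i) vanishes-at-length
  where
  vanishes-at-length : partAt μ (length μ ∸ toℕ i + toℕ i) < partAt μ (toℕ i)
  vanishes-at-length rewrite m∸n+n≡m (<⇒≤ (toℕ<n i)) | partAt-length μ =
    partAt-positive μ>0 (toℕ<n i)
... | J , i≤J , same , is-corner = corner J i≤J same is-corner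
  (subst (λ v → ∀ j → partAt (decLast v μ) j + δ j J ≡ partAt μ j)
    (trans same (sym (lookup≡partAt μ i)))
    (decLast-removes μ↓ μ>0 is-corner))

weaklyIncr-∷⇔ : ∀ {k} (A : Vec ℕ (suc k)) c (d : Vec ℕ k) →
  WeaklyIncr (toList A) (toList (c ∷ d)) ⇔
  (WeaklyIncr (toList (V.tail A)) (toList d) × FirstCond (toList A) (toList d) c)
weaklyIncr-∷⇔ (a ∷ [])     c []      = mk⇔ (λ _ → tt , tt) (λ _ → tt)
weaklyIncr-∷⇔ (a ∷ a′ ∷ A) c (_ ∷ d) = mk⇔ swap swap

xLast^-·ₘ-embed : ∀ {k} e (m : Monomial k) → xLast^ k e ·ₘ embed m ≡ m ∷ʳ e
xLast^-·ₘ-embed e []      = cong (_∷ []) (+-identityʳ e)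
xLast^-·ₘ-embed e (x ∷ m) = cong (x ∷_) (xLast^-·ₘ-embed e m)

mono-∷ : ∀ {k} c (d : Vec ℕ k) → mono (c ∷ d) ≡ xLast^ k c ·ₘ embed (mono d)
mono-∷ c d = trans (reverse-∷ c d) (sym (xLast^-·ₘ-embed c (mono d)))

xLast^-·ₘ-embed-injectiveˡ : ∀ {k} s t (m m′ : Monomial k) →
  xLast^ k s ·ₘ embed m ≡ xLast^ k t ·ₘ embed m′ → s ≡ t
xLast^-·ₘ-embed-injectiveˡ s t m m′ eq =
  ∷ʳ-injectiveʳ m m′ (trans (sym (xLast^-·ₘ-embed s m)) (trans eq (xLast^-·ₘ-embed t m′)))

Piece-disjoint : ∀ {k} {A : Vec ℕ (suc k)} {μ} (i j : Fin (length μ)) (m : Monomial (suc k)) →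
  Piece A μ i m → Piece A μ j m → i ≡ j
Piece-disjoint i j _ (m₁ , _ , eq₁) (m₂ , _ , eq₂) =
  toℕ-injective (xLast^-·ₘ-embed-injectiveˡ (toℕ i) (toℕ j) m₁ m₂ (trans (sym eq₁) eq₂))

module _ {μ : List ℕ} (μ↓ : Decreasing μ) (μ>0 : All (0 <_) μ) where

  subYamanouchi-head< : ∀ {k p} {d : Vec ℕ k} → SubYamanouchi μ (p ∷ d) → p < length μ
  subYamanouchi-head< (v₁ ∷ v , _ , content , p≤v₁ PW.∷ _) =
    ≤-<-trans p≤v₁ (positive⇒<length μ (subst (0 <_) v₁-occurs z<s))
    where
    v₁-occurs : suc (count v₁ (toList v)) ≡ partAt μ v₁
    v₁-occurs = trans (sym (count-head v₁ (toList v))) (content v₁)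

  subYamanouchi-∷⁻ : ∀ {k} (i : Fin (length μ)) {d : Vec ℕ k} →
    SubYamanouchi μ (toℕ i ∷ d) → SubYamanouchi (removeCell μ i) d
  subYamanouchi-∷⁻ i (v₁ ∷ v , yam , content , i≤v₁ PW.∷ d≤v)
    with removeCell-corner μ↓ μ>0 i
  ... | corner J i≤J same is-corner removes =
    subYamanouchi′-≤ d≤v (raise-letter v J≤v₁ (removal-nonincreasing removes μ↓′ is-corner)
                                        (yamanouchi-tail yam) tail-content)
    where
    μ↓′ : Nonincreasing (partAt μ)
    μ↓′ = partAt-nonincreasing μ↓
    J≤v₁ : J ≤ v₁
    J≤v₁ = ≮⇒≥ λ v₁<J → <-irrefl same (begin-strict
      partAt μ J                     ≤⟨ nonincreasing-antitone μ↓′ v₁<J ⟩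
      partAt μ (suc v₁)              ≡⟨ content (suc v₁) ⟨
      count (suc v₁) (v₁ ∷ toList v) <⟨ yamanouchi-head-corner yam ⟩
      count v₁ (v₁ ∷ toList v)       ≡⟨ content v₁ ⟩
      partAt μ v₁                    ≤⟨ nonincreasing-antitone μ↓′ i≤v₁ ⟩
      partAt μ (toℕ i)               ∎)
      where open ≤-Reasoning
    tail-content : ∀ j → count j (toList v) + δ j v₁ ≡ partAt (removeCell μ i) j + δ j J
    tail-content j = begin
      count j (toList v) + δ j v₁    ≡⟨ +-comm (count j (toList v)) (δ j v₁) ⟩
      δ j v₁ + count j (toList v)    ≡⟨ count-∷ j v₁ (toList v) ⟨
      count j (v₁ ∷ toList v)        ≡⟨ content j ⟩
      partAt μ j                     ≡⟨ removes j ⟨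
      partAt (removeCell μ i) j + δ j J ∎
      where open ≡-Reasoning

  subYamanouchi-∷⁺ : ∀ {k} (i : Fin (length μ)) {d : Vec ℕ k} →
    SubYamanouchi (removeCell μ i) d → SubYamanouchi μ (toℕ i ∷ d)
  subYamanouchi-∷⁺ i (u , yam , content , d≤u) with removeCell-corner μ↓ μ>0 i
  ... | corner J i≤J _ _ removes =
    J ∷ u , yamanouchi-∷ (partAt-nonincreasing μ↓) content′ yam , content′ , i≤J PW.∷ d≤u
    where
    content′ : Content (J ∷ toList u) (partAt μ)
    content′ j = begin
      count j (J ∷ toList u)            ≡⟨ count-∷ j J (toList u) ⟩
      δ j J + count j (toList u)        ≡⟨ +-comm (δ j J) _ ⟩
      count j (toList u) + δ j J        ≡⟨ cong (_+ δ j J) (content j) ⟩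
      partAt (removeCell μ i) j + δ j J ≡⟨ removes j ⟩
      partAt μ j                        ∎
      where open ≡-Reasoning

  C⇒Piece : ∀ {k} {A : Vec ℕ (suc k)} {m} → C A μ m → Σ (Fin (length μ)) λ i → Piece A μ i m
  C⇒Piece {A = A} (c ∷ d , sy , wi , refl)
    with fromℕ< (subYamanouchi-head< sy) | toℕ-fromℕ< (subYamanouchi-head< sy)
  ... | i | refl with Equivalence.to (weaklyIncr-∷⇔ A (toℕ i) d) wi
  ... | wi-tail , first =
    i , mono d , (d , subYamanouchi-∷⁻ i sy , wi-tail , first , refl) , mono-∷ (toℕ i) d

  Piece⇒C : ∀ {k} {A : Vec ℕ (suc k)} {i m} → Piece A μ i m → C A μ m
  Piece⇒C {A = A} {i} (_ , (d , sy , wi-tail , first , refl) , refl) =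
    toℕ i ∷ d , subYamanouchi-∷⁺ i sy ,
    Equivalence.from (weaklyIncr-∷⇔ A (toℕ i) d) (wi-tail , first) , mono-∷ (toℕ i) d

mainTheorem9 : (k : ℕ) (A : Vec ℕ (suc k)) (μ : List ℕ) →
    IsPartitionOf (suc k) μ → IsOrderedMultiset A →
    ((m : Monomial (suc k)) → C A μ m ⇔ Σ (Fin (length μ)) (λ i → Piece A μ i m))
    × ((i j : Fin (length μ)) (m : Monomial (suc k)) → Piece A μ i m → Piece A μ j m → i ≡ j)
mainTheorem9 k A μ (μ>0 , μ↓ , _) _ =
  (λ _ → mk⇔ (C⇒Piece μ↓ μ>0) (λ (_ , piece) → Piece⇒C μ↓ μ>0 piece)) , Piece-disjoint {μ = μ}
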